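{- Let $\ast_c$ be a choice revision on $K$. Then $\ast_c$ satisfies $\ast_c$-closure, $\ast_c$-success, $\ast_c$-vacuity, $\ast_c$-confirmation, $\ast_c$-reciprocity and $\ast_c$-consistency iff there is a standard multi-believability relation $\preceq_{c}$ such that for every finite $A$: $K \ast_c A = \{\varphi \mid A \simeq_{c} \{\psi\wedge\varphi \mid \psi\in A\}\}$ if $A \prec_{c} \emptyset$, and $K \ast_c A = K$ otherwise.
   Context: $\mathcal{L}$ is a propositional language (not necessarily finite) with consequence operation $\mathrm{Cn}$ (supraclassical, compact, deduction property); $X\vdash\varphi$ means $\varphi\in\mathrm{Cn}(X)$; $\bot$ is a contradiction. $K$ is a fixed consistent belief set ($K=\mathrm{Cn}(K)$). $A\equiv B$ means every element of $A$ is logically equivalent to some element of $B$ and vice versa. A choice revision $\ast_c$ on $K$ maps each finite $A\subseteq\mathcal{L}$ to a set $K\ast_c A$. Postulates (finite $A,B$): closure: $\mathrm{Cn}(K\ast_c A)=K\ast_c A$; success: if $A\neq\emptyset$ then $A\cap(K\ast_c A)\neq\emptyset$; vacuity: if $A=\emptyset$ then $K\ast_c A=K$; confirmation: if $A\cap K\neq\emptyset$ then $K\ast_c A=K$; reciprocity: if $(K\ast_c A)\cap B\neq\emptyset$ and $(K\ast_c B)\cap A\neq\emptyset$ then $K\ast_c A=K\ast_c B$; consistency: if $A\not\equiv\{\bot\}$ then $K\ast_c A\nvdash\bot$. A multi-believability relation $\preceq_{c}$ is a binary relation on finite subsets of $\mathcal{L}$ (symmetric part $\simeq_{c}$, strict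 part $\prec_{c}$; $\{\varphi\}$ written $\varphi$). It is standard iff it satisfies, for finite $A,B,C$: transitivity; weak coupling (if $A\simeq_{c}\{\varphi\wedge\psi\mid\varphi\in A,\psi\in B\}$ and $A\simeq_{c}\{\varphi\wedge\chi\mid\varphi\in A,\chi\in C\}$ then $A\simeq_{c}\{(\varphi\wedge\psi)\wedge\chi\mid\varphi\in A,\psi\in B,\chi\in C\}$); coupling (if $A\simeq_{c}B$ then $A\simeq_{c}\{\varphi\wedge\psi\mid\varphi\in A,\psi\in B\}$); counter dominance (if for every $\varphi\in B$ there is $\psi\in A$ with $\varphi\vdash\psi$ then $A\preceq_{c}B$); minimality ($A\preceq_{c}B$ for all $B$ iff $A\cap K\neq\emptyset$); maximality (if $B$ non-empty and $A\preceq_{c}B$ for all non-empty $A$ then $B\equiv\{\bot\}$); completeness ($A\preceq_{c}B$ or $B\preceq_{c}A$); determination ($A\prec_{c}\emptyset$ for every non-empty $A$); union ($A\preceq_{c}A\cup B$ or $B\preceq_{c}A\cup B$). -}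

module Defs where

open import Data.Bool using (Bool; true; false; not; _∧_; _∨_)
open import Data.List using (List; []; _∷_; _++_; map; concatMap)
open import Data.List.Membership.Propositional using (_∈_)
open import Data.Product using (Σ; ∃; ∃-syntax; _×_; _,_)
open import Data.Sum using (_⊎_)
open import Relation.Nullary using (¬_)
open import Relation.Binary.PropositionalEquality using (_≡_)
open import Level using (Level; 0ℓ) renaming (suc to lsuc)

data Form (Atom : Set) : Set where
  atom : Atom → Form Atom
  ⊤′ ⊥′ : Form Atom
  ¬′_ : Form Atom → Form Atom
  _∧′_ _∨′_ _⇒′_ _⇔′_ : Form Atom → Form Atom → Form Atom

infix  7 ¬′_
infixr 6 _∧′_
infixr 5 _∨′_
infixr 4 _⇒′_ _⇔′_

eval : {Atom : Set} → (Atom → Bool) → Form Atom → Bool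
eval v (atom a) = v a
eval v ⊤′ = true
eval v ⊥′ = false
eval v (¬′ φ) = not (eval v φ)
eval v (φ ∧′ ψ) = eval v φ ∧ eval v ψ
eval v (φ ∨′ ψ) = eval v φ ∨ eval v ψ
eval v (φ ⇒′ ψ) = not (eval v φ) ∨ eval v ψ
eval v (φ ⇔′ ψ) = (not (eval v φ) ∨ eval v ψ) ∧ (not (eval v ψ) ∨ eval v φ)

Sent : Set → Set₁
Sent Atom = Form Atom → Set

_⊆_ : {Atom : Set} → Sent Atom → Sent Atom → Set
X ⊆ Y = ∀ φ → X φ → Y φ

_≐_ : {Atom : Set} → Sent Atom → Sent Atom → Set
X ≐ Y = ∀ φ → (X φ → Y φ) × (Y φ → X φ)

⟦_⟧ : {Atom : Set} → List (Form Atom) → Sent Atom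
⟦ A ⟧ φ = φ ∈ A

_⨄_ : {Atom : Set} → Sent Atom → Form Atom → Sent Atom
(X ⨄ φ) ψ = X ψ ⊎ ψ ≡ φ

_⊨_ : {Atom : Set} → Sent Atom → Form Atom → Set
X ⊨ φ = ∀ v → (∀ ψ → X ψ → eval v ψ ≡ true) → eval v φ ≡ true

record ConsequenceOp (Atom : Set) : Set₁ where
  field
    Cn : Sent Atom → Sent Atom
    inclusion   : ∀ X → X ⊆ Cn X
    monotony    : ∀ X Y → X ⊆ Y → Cn X ⊆ Cn Y
    iteration   : ∀ X → Cn (Cn X) ⊆ Cn X
    supraclassical : ∀ X φ → X ⊨ φ → Cn X φ
    compact     : ∀ X φ → Cn X φ → ∃[ Y ] (⟦ Y ⟧ ⊆ X × Cn ⟦ Y ⟧ φ)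
    deduction   : ∀ X φ ψ → (Cn (X ⨄ φ) ψ → Cn X (φ ⇒′ ψ))
                               × (Cn X (φ ⇒′ ψ) → Cn (X ⨄ φ) ψ)

module WithCn {Atom : Set} (C : ConsequenceOp Atom) where
  open ConsequenceOp C public

  L : Set
  L = Form Atom

  FinSet : Set
  FinSet = List L

  _⊢_ : Sent Atom → L → Set
  X ⊢ φ = Cn X φ

  _⊢₁_ : L → L → Set
  φ ⊢₁ ψ = (λ χ → χ ≡ φ) ⊢ ψ

  LogEquiv : L → L → Set
  LogEquiv φ ψ = (φ ⊢₁ ψ) × (ψ ⊢₁ φ)

  _≡ₗ_ : FinSet → FinSet → Set
  A ≡ₗ B = (∀ φ → φ ∈ A → ∃[ ψ ] (ψ ∈ B × LogEquiv φ ψ))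
         × (∀ ψ → ψ ∈ B → ∃[ φ ] (φ ∈ A × LogEquiv φ ψ))

  _≈ₛ_ : FinSet → FinSet → Set
  A ≈ₛ B = ∀ φ → (φ ∈ A → φ ∈ B) × (φ ∈ B → φ ∈ A)

  Meets : FinSet → Sent Atom → Set
  Meets A X = ∃[ φ ] (φ ∈ A × X φ)

  BeliefSet : Sent Atom → Set
  BeliefSet K = Cn K ≐ K

  Consistent : Sent Atom → Set
  Consistent X = ¬ (X ⊢ ⊥′)

  _⊗_ : FinSet → FinSet → FinSet
  A ⊗ B = concatMap (λ φ → map (λ ψ → φ ∧′ ψ) B) A

  -- Finite sets are represented by lists, so a choice
  -- revision is required to give the same result on lists with the
  -- same members.

  record ChoiceRevision (K : Sent Atom) : Set₁ where
    field
      _∗_ : FinSet → Sent Atom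
      set-invariant : ∀ A B → A ≈ₛ B → _∗_ A ≐ _∗_ B

  module Postulates {K : Sent Atom} (R : ChoiceRevision K) where
    private
      rev : FinSet → Sent Atom
      rev = ChoiceRevision._∗_ R

    Closure Success Vacuity Confirmation Reciprocity Consistency : Set
    Closure = ∀ A → Cn (rev A) ≐ rev A
    Success = ∀ A → ¬ (A ≡ []) → Meets A (rev A)
    Vacuity = ∀ A → A ≡ [] → rev A ≐ K
    Confirmation = ∀ A → Meets A K → rev A ≐ K
    Reciprocity = ∀ A B → Meets B (rev A)
                        → Meets A (rev B)
                        → rev A ≐ rev B
    Consistency = ∀ A → ¬ (A ≡ₗ (⊥′ ∷ [])) → Consistent (rev A)

    AllPostulates : Set
    AllPostulates = Closure × Success × Vacuity × Confirmation × Reciprocity × Consistency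

  Rel₂ : Set₁
  Rel₂ = FinSet → FinSet → Set

  module MB (K : Sent Atom) (_≼_ : Rel₂) where
    _≃_ : FinSet → FinSet → Set
    A ≃ B = (A ≼ B) × (B ≼ A)

    _≺_ : FinSet → FinSet → Set
    A ≺ B = (A ≼ B) × ¬ (B ≼ A)

    Transitivity WeakCoupling Coupling CounterDominance Minimality
      Maximality Completeness Determination Union : Set
    Transitivity = ∀ A B C → A ≼ B → B ≼ C → A ≼ C
    WeakCoupling = ∀ A B C → A ≃ (A ⊗ B) → A ≃ (A ⊗ C) → A ≃ ((A ⊗ B) ⊗ C)
    Coupling = ∀ A B → A ≃ B → A ≃ (A ⊗ B)
    CounterDominance = ∀ A B → (∀ φ → φ ∈ B → ∃[ ψ ] (ψ ∈ A × φ ⊢₁ ψ)) → A ≼ B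
    Minimality = ∀ A → ((∀ B → A ≼ B) → Meets A K) × (Meets A K → ∀ B → A ≼ B)
    Maximality = ∀ B → ¬ (B ≡ []) → (∀ A → ¬ (A ≡ []) → A ≼ B) → B ≡ₗ (⊥′ ∷ [])
    Completeness = ∀ A B → (A ≼ B) ⊎ (B ≼ A)
    Determination = ∀ A → ¬ (A ≡ []) → A ≺ []
    Union = ∀ A B → (A ≼ (A ++ B)) ⊎ (B ≼ (A ++ B))

    Standard : Set
    Standard = Transitivity × WeakCoupling × Coupling × CounterDominance
             × Minimality × Maximality × Completeness × Determination × Union

    Represents : ChoiceRevision K → Set
    Represents R = ∀ A →
        (A ≺ [] → ChoiceRevision._∗_ R A ≐ (λ φ → A ≃ map (λ ψ → ψ ∧′ φ) A))
      × (¬ (A ≺ []) → ChoiceRevision._∗_ R A ≐ K)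

-- Both directions turn on the set A ∧ φ = {ψ ∧ φ | ψ ∈ A}: φ is accepted when
-- revising by A exactly when A ∧ φ is as believable as A.  Given a standard
-- relation, the accepted sentences are closed under single-premise entailment
-- (counter dominance) and under conjunction (weak coupling), hence under Cn by
-- compactness, and the postulates follow.  Conversely, from a revision
-- satisfying the postulates put A ≼ B iff revising by A ∪ B accepts a member
-- of A (and A ≼ ∅ always).  Reciprocity makes the revisions by two sets
-- coincide as soon as every member of one entails a member of the other and
-- the first meets the revision by the second; this yields all the axioms.
-- Maximality needs a classical step, recovered from compactness and the
-- consistency of K.
module Submission where

open import Defs
open import Data.Bool using (true; _∧_)
open import Data.Bool.Properties using (∧-conicalˡ; ∧-conicalʳ; ∧-assoc; ∧-identityʳ)
open import Data.Empty using (⊥-elim)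
open import Data.List using (List; []; _∷_; _++_; map; cartesianProductWith)
open import Data.List.Properties using (map-id; map-∘)
open import Data.List.Membership.Propositional using (_∈_)
open import Data.List.Membership.Propositional.Properties
  using (∈-map⁺; ∈-map⁻; ∈-++⁺ˡ; ∈-++⁺ʳ; ∈-++⁻; ∈-cartesianProductWith⁺; ∈-cartesianProductWith⁻)
open import Data.List.Relation.Binary.Subset.Propositional using () renaming (_⊆_ to _⊆ₗ_)
open import Data.List.Relation.Binary.Subset.Propositional.Properties using (xs⊆xs++ys; xs⊆ys++xs)
open import Data.List.Relation.Unary.Any using (here; there)
open import Data.Product using (∃-syntax; _×_; _,_; proj₁; proj₂)
open import Data.Sum using (_⊎_; inj₁; inj₂; [_,_]′)
open import Function using (id; _∘_; case_of_)
open import Function.Bundles using (_⇔_; mk⇔)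
open import Relation.Nullary using (¬_)
open import Relation.Binary.PropositionalEquality using (_≡_; refl; sym; trans; cong; cong₂; subst)

++-⊆ₗ : ∀ {A : Set} {xs ys zs : List A} → xs ⊆ₗ zs → ys ⊆ₗ zs → xs ++ ys ⊆ₗ zs
++-⊆ₗ {xs = xs} xs⊆zs ys⊆zs = [ xs⊆zs , ys⊆zs ]′ ∘ ∈-++⁻ xs

∈⇒≢[] : ∀ {A : Set} {x : A} {xs : List A} → x ∈ xs → ¬ xs ≡ []
∈⇒≢[] {xs = []} ()
∈⇒≢[] {xs = _ ∷ _} _ ()

module Entailment {Atom : Set} (C : ConsequenceOp Atom) where
  open WithCn C

  ⟪_⟫ : L → Sent Atom
  ⟪ φ ⟫ χ = χ ≡ φ

  ≐-sym : ∀ {X Y : Sent Atom} → X ≐ Y → Y ≐ X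
  ≐-sym X≐Y φ = proj₂ (X≐Y φ) , proj₁ (X≐Y φ)

  ≐-trans : ∀ {X Y Z : Sent Atom} → X ≐ Y → Y ≐ Z → X ≐ Z
  ≐-trans X≐Y Y≐Z φ = proj₁ (Y≐Z φ) ∘ proj₁ (X≐Y φ) , proj₂ (X≐Y φ) ∘ proj₂ (Y≐Z φ)

  Meets⇒≢[] : ∀ {A X} → Meets A X → ¬ A ≡ []
  Meets⇒≢[] (_ , φ∈A , _) = ∈⇒≢[] φ∈A

  Cn-cut : ∀ {X Y φ} → Y ⊆ Cn X → Cn Y φ → Cn X φ
  Cn-cut {X} {Y} {φ} Y⊆CnX CnYφ = iteration X φ (monotony Y (Cn X) Y⊆CnX φ CnYφ)

  Cn-∧ : ∀ {X φ ψ} → Cn X φ → Cn X ψ → Cn X (φ ∧′ ψ)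
  Cn-∧ {X} {φ} {ψ} Cnφ Cnψ = Cn-cut {Y = ⟪ φ ⟫ ⨄ ψ} premises
    (supraclassical _ _ λ v sat → cong₂ _∧_ (sat φ (inj₁ refl)) (sat ψ (inj₂ refl)))
    where
    premises : (⟪ φ ⟫ ⨄ ψ) ⊆ Cn X
    premises _ (inj₁ refl) = Cnφ
    premises _ (inj₂ refl) = Cnψ

  ⊨⇒⊢₁ : ∀ {φ ψ} → (∀ v → eval v φ ≡ true → eval v ψ ≡ true) → φ ⊢₁ ψ
  ⊨⇒⊢₁ {φ} {ψ} sem = supraclassical ⟪ φ ⟫ ψ λ v sat → sem v (sat φ refl)

  ⊢₁-refl : ∀ {φ} → φ ⊢₁ φ
  ⊢₁-refl {φ} = inclusion ⟪ φ ⟫ φ refl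

  ⊢₁-trans : ∀ {φ ψ χ} → φ ⊢₁ ψ → ψ ⊢₁ χ → φ ⊢₁ χ
  ⊢₁-trans φ⊢ψ ψ⊢χ = Cn-cut (λ { _ refl → φ⊢ψ }) ψ⊢χ

  ∧-⊢₁ˡ : ∀ {φ ψ} → (φ ∧′ ψ) ⊢₁ φ
  ∧-⊢₁ˡ = ⊨⇒⊢₁ λ v → ∧-conicalˡ _ _

  ∧-⊢₁ʳ : ∀ {φ ψ} → (φ ∧′ ψ) ⊢₁ ψ
  ∧-⊢₁ʳ = ⊨⇒⊢₁ λ v → ∧-conicalʳ _ _

  ∧-mono-⊢₁ : ∀ {φ φ′ ψ ψ′} → φ ⊢₁ φ′ → ψ ⊢₁ ψ′ → (φ ∧′ ψ) ⊢₁ (φ′ ∧′ ψ′)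
  ∧-mono-⊢₁ φ⊢φ′ ψ⊢ψ′ = Cn-∧ (⊢₁-trans ∧-⊢₁ˡ φ⊢φ′) (⊢₁-trans ∧-⊢₁ʳ ψ⊢ψ′)

  ∧-assoc-⊢₁ : ∀ {φ ψ χ} → ((φ ∧′ ψ) ∧′ χ) ⊢₁ (φ ∧′ (ψ ∧′ χ))
  ∧-assoc-⊢₁ {φ} {ψ} {χ} = ⊨⇒⊢₁ λ v → trans (sym (∧-assoc (eval v φ) (eval v ψ) (eval v χ)))

  ⊢₁-∧⊤ : ∀ {φ} → φ ⊢₁ (φ ∧′ ⊤′)
  ⊢₁-∧⊤ = ⊨⇒⊢₁ λ v → trans (∧-identityʳ _)

  ⊥-⊢₁ : ∀ {φ} → ⊥′ ⊢₁ φ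
  ⊥-⊢₁ = ⊨⇒⊢₁ λ v ()

  BeliefSet-⊢₁ : ∀ {S φ ψ} → BeliefSet S → S φ → φ ⊢₁ ψ → S ψ
  BeliefSet-⊢₁ {S} {φ} {ψ} S-closed Sφ φ⊢ψ =
    proj₁ (S-closed ψ) (Cn-cut (λ { _ refl → inclusion S φ Sφ }) φ⊢ψ)

  BeliefSet-∧ : ∀ {S φ ψ} → BeliefSet S → S φ → S ψ → S (φ ∧′ ψ)
  BeliefSet-∧ {S} {φ} {ψ} S-closed Sφ Sψ =
    proj₁ (S-closed _) (Cn-∧ (inclusion S φ Sφ) (inclusion S ψ Sψ))

  BeliefSet-⊤ : ∀ {S} → BeliefSet S → S ⊤′
  BeliefSet-⊤ {S} S-closed = proj₁ (S-closed ⊤′) (supraclassical S ⊤′ λ _ _ → refl)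

  BeliefSet-resp-≐ : ∀ {X Y} → X ≐ Y → BeliefSet Y → BeliefSet X
  BeliefSet-resp-≐ {X} {Y} X≐Y Y-closed φ =
      (λ CnXφ → proj₂ (X≐Y φ) (proj₁ (Y-closed φ) (monotony X Y (proj₁ ∘ X≐Y) φ CnXφ)))
    , inclusion X φ

  ⋀ : List L → L
  ⋀ [] = ⊤′
  ⋀ (φ ∷ Y) = φ ∧′ ⋀ Y

  ⋀-⊢₁-∈ : ∀ {Y φ} → φ ∈ Y → ⋀ Y ⊢₁ φ
  ⋀-⊢₁-∈ (here refl) = ∧-⊢₁ˡ
  ⋀-⊢₁-∈ (there φ∈Y) = ⊢₁-trans ∧-⊢₁ʳ (⋀-⊢₁-∈ φ∈Y)

  ⊢₁-∧-closed⇒BeliefSet : ∀ {S}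
    → (∀ {φ ψ} → S φ → φ ⊢₁ ψ → S ψ) → S ⊤′ → (∀ {φ ψ} → S φ → S ψ → S (φ ∧′ ψ))
    → BeliefSet S
  ⊢₁-∧-closed⇒BeliefSet {S} S-⊢₁ S-⊤ S-∧ φ = Cn-closed , inclusion S φ
    where
    S-⋀ : ∀ Y → ⟦ Y ⟧ ⊆ S → S (⋀ Y)
    S-⋀ [] _ = S-⊤
    S-⋀ (ψ ∷ Y) Y⊆S = S-∧ (Y⊆S ψ (here refl)) (S-⋀ Y λ χ → Y⊆S χ ∘ there)

    Cn-closed : Cn S φ → S φ
    Cn-closed CnSφ with compact S φ CnSφ
    ... | Y , Y⊆S , CnYφ = S-⊢₁ (S-⋀ Y Y⊆S) (Cn-cut (λ _ → ⋀-⊢₁-∈) CnYφ)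

  -- The set {φ | Q} classically entails ⊥ unless Q holds; by compactness some
  -- finite part of it does, that part is non-empty since ∅ is consistent, and
  -- any of its members is a proof of Q.
  ¬¬-elim : Consistent ⟦ [] ⟧ → {Q : Set} → ¬ ¬ Q → Q
  ¬¬-elim ∅-consistent {Q} ¬¬Q
    with compact (λ _ → Q) ⊥′
           (supraclassical _ ⊥′ λ v sat → ⊥-elim (¬¬Q λ q → case sat ⊥′ q of λ ()))
  ... | [] , _ , Cn∅⊥ = ⊥-elim (∅-consistent Cn∅⊥)
  ... | φ ∷ _ , Y⊆Q , _ = Y⊆Q φ (here refl)

  ≡ₗ⊥⇒⊢₁⊥ : ∀ {A φ} → A ≡ₗ (⊥′ ∷ []) → φ ∈ A → φ ⊢₁ ⊥′
  ≡ₗ⊥⇒⊢₁⊥ A≡ₗ⊥ φ∈A with proj₁ A≡ₗ⊥ _ φ∈A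
  ... | _ , here refl , φ⊢⊥ , _ = φ⊢⊥

  ⊢₁⊥⇒≡ₗ⊥ : ∀ {φ A} → (∀ {ψ} → ψ ∈ φ ∷ A → ψ ⊢₁ ⊥′) → (φ ∷ A) ≡ₗ (⊥′ ∷ [])
  ⊢₁⊥⇒≡ₗ⊥ all⊢⊥ = (λ _ ψ∈A → ⊥′ , here refl , all⊢⊥ ψ∈A , ⊥-⊢₁)
                 , λ { _ (here refl) → _ , here refl , all⊢⊥ (here refl) , ⊥-⊢₁ }

  infixl 25 _∧ᵣ_

  _∧ᵣ_ : FinSet → L → FinSet
  A ∧ᵣ φ = map (_∧′ φ) A

  ⊗-singleton : ∀ A φ → A ⊗ (φ ∷ []) ≡ A ∧ᵣ φ
  ⊗-singleton [] φ = refl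
  ⊗-singleton (ψ ∷ A) φ = cong (ψ ∧′ φ ∷_) (⊗-singleton A φ)

  ⊗≡cartesianProductWith : ∀ A B → A ⊗ B ≡ cartesianProductWith _∧′_ A B
  ⊗≡cartesianProductWith [] B = refl
  ⊗≡cartesianProductWith (φ ∷ A) B = cong (map (φ ∧′_) B ++_) (⊗≡cartesianProductWith A B)

  ∈-⊗⁺ : ∀ {A B φ ψ} → φ ∈ A → ψ ∈ B → (φ ∧′ ψ) ∈ A ⊗ B
  ∈-⊗⁺ {A} {B} φ∈A ψ∈B =
    subst (_ ∈_) (sym (⊗≡cartesianProductWith A B)) (∈-cartesianProductWith⁺ _∧′_ φ∈A ψ∈B)

  ∈-⊗⁻ : ∀ A B {χ} → χ ∈ A ⊗ B → ∃[ φ ] ∃[ ψ ] (φ ∈ A × ψ ∈ B × χ ≡ φ ∧′ ψ)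
  ∈-⊗⁻ A B χ∈A⊗B =
    ∈-cartesianProductWith⁻ _∧′_ A B (subst (_ ∈_) (⊗≡cartesianProductWith A B) χ∈A⊗B)

  infix 4 _⊑_

  _⊑_ : FinSet → FinSet → Set
  B ⊑ A = ∀ φ → φ ∈ B → ∃[ ψ ] (ψ ∈ A × φ ⊢₁ ψ)

  ⊆⇒⊑ : ∀ {A B} → B ⊆ₗ A → B ⊑ A
  ⊆⇒⊑ B⊆A φ φ∈B = φ , B⊆A φ∈B , ⊢₁-refl

  ⊑-refl : ∀ {A} → A ⊑ A
  ⊑-refl = ⊆⇒⊑ id

  ⊑-trans : ∀ {A B D} → A ⊑ B → B ⊑ D → A ⊑ D
  ⊑-trans A⊑B B⊑D φ φ∈A with A⊑B φ φ∈A
  ... | ψ , ψ∈B , φ⊢ψ with B⊑D ψ ψ∈B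
  ...   | χ , χ∈D , ψ⊢χ = χ , χ∈D , ⊢₁-trans φ⊢ψ ψ⊢χ

  ++-⊑ : ∀ {A B D} → A ⊑ D → B ⊑ D → A ++ B ⊑ D
  ++-⊑ {A} A⊑D B⊑D φ = [ A⊑D φ , B⊑D φ ]′ ∘ ∈-++⁻ A

  map-⊑ : ∀ {f g : L → L} A → (∀ φ → f φ ⊢₁ g φ) → map f A ⊑ map g A
  map-⊑ {f} {g} A f⊢g χ χ∈fA with ∈-map⁻ f χ∈fA
  ... | φ , φ∈A , refl = g φ , ∈-map⁺ g φ∈A , f⊢g φ

  ∧ᵣ-⊑ : ∀ {A φ} → A ∧ᵣ φ ⊑ A
  ∧ᵣ-⊑ {A} {φ} = subst (A ∧ᵣ φ ⊑_) (map-id A) (map-⊑ {g = id} A λ _ → ∧-⊢₁ˡ)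

  ∧ᵣ-⊑-singleton : ∀ {A φ} → A ∧ᵣ φ ⊑ φ ∷ []
  ∧ᵣ-⊑-singleton {A} {φ} χ χ∈A∧φ with ∈-map⁻ (_∧′ φ) χ∈A∧φ
  ... | _ , _ , refl = φ , here refl , ∧-⊢₁ʳ

  ∧ᵣ-mono-⊑ : ∀ {A B φ} → A ⊑ B → A ∧ᵣ φ ⊑ B ∧ᵣ φ
  ∧ᵣ-mono-⊑ {φ = φ} A⊑B χ χ∈A∧φ with ∈-map⁻ (_∧′ φ) χ∈A∧φ
  ... | ψ , ψ∈A , refl with A⊑B ψ ψ∈A
  ...   | ψ′ , ψ′∈B , ψ⊢ψ′ = ψ′ ∧′ φ , ∈-map⁺ (_∧′ φ) ψ′∈B , ∧-mono-⊢₁ ψ⊢ψ′ ⊢₁-refl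

  ⊗-⊑ˡ : ∀ {A B} → A ⊗ B ⊑ A
  ⊗-⊑ˡ {A} {B} χ χ∈A⊗B with ∈-⊗⁻ A B χ∈A⊗B
  ... | φ , _ , φ∈A , _ , refl = φ , φ∈A , ∧-⊢₁ˡ

  ⊗-⊑ʳ : ∀ {A B} → A ⊗ B ⊑ B
  ⊗-⊑ʳ {A} {B} χ χ∈A⊗B with ∈-⊗⁻ A B χ∈A⊗B
  ... | _ , ψ , _ , ψ∈B , refl = ψ , ψ∈B , ∧-⊢₁ʳ

module Soundness {Atom : Set} (C : ConsequenceOp Atom) (K : Sent Atom)
  (K-closed : WithCn.BeliefSet C K) (K-consistent : WithCn.Consistent C K)
  (R : WithCn.ChoiceRevision C K) (_≼_ : WithCn.Rel₂ C) where
  open WithCn C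
  open Entailment C
  open MB K _≼_
  open ChoiceRevision R renaming (_∗_ to rev)
  open Postulates R

  Rev≼ : FinSet → Sent Atom
  Rev≼ A φ = A ≃ A ∧ᵣ φ

  Rev≼⇒≃⊗ : ∀ {A φ} → Rev≼ A φ → A ≃ (A ⊗ (φ ∷ []))
  Rev≼⇒≃⊗ {A} {φ} = subst (A ≃_) (sym (⊗-singleton A φ))

  module _ (≼-trans : Transitivity) (weak-coupling : WeakCoupling) (coupling : Coupling)
    (counter-dominance : CounterDominance) (minimality : Minimality) (maximality : Maximality)
    (determination : Determination) (union : Union) (represents : Represents R) where

    ≼-refl : ∀ A → A ≼ A
    ≼-refl A = counter-dominance A A ⊑-refl

    ≼-∧ᵣ : ∀ A φ → A ≼ A ∧ᵣ φ
    ≼-∧ᵣ A φ = counter-dominance A (A ∧ᵣ φ) ∧ᵣ-⊑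

    rev≐Rev≼ : ∀ {A} → ¬ A ≡ [] → rev A ≐ Rev≼ A
    rev≐Rev≼ {A} A≢[] = proj₁ (represents A) (determination A A≢[])

    rev[]≐K : rev [] ≐ K
    rev[]≐K = proj₂ (represents []) λ []≺[] → proj₂ []≺[] (≼-refl [])

    Rev≼-⊢₁ : ∀ {A φ ψ} → Rev≼ A φ → φ ⊢₁ ψ → Rev≼ A ψ
    Rev≼-⊢₁ {A} {φ} {ψ} (_ , A∧φ≼A) φ⊢ψ = ≼-∧ᵣ A ψ
      , ≼-trans _ _ _ (counter-dominance _ _ (map-⊑ A λ _ → ∧-mono-⊢₁ ⊢₁-refl φ⊢ψ)) A∧φ≼A

    Rev≼-⊤ : ∀ A → Rev≼ A ⊤′
    Rev≼-⊤ A = ≼-∧ᵣ A ⊤′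
      , counter-dominance _ A (subst (_⊑ A ∧ᵣ ⊤′) (map-id A) (map-⊑ A λ _ → ⊢₁-∧⊤))

    Rev≼-∧ : ∀ {A φ ψ} → Rev≼ A φ → Rev≼ A ψ → Rev≼ A (φ ∧′ ψ)
    Rev≼-∧ {A} {φ} {ψ} Aφ Aψ = ≼-∧ᵣ A (φ ∧′ ψ)
      , ≼-trans _ _ _ (counter-dominance _ _ A∧φ∧ψ⊑A∧[φ∧ψ]) A∧φ∧ψ≼A
      where
      A∧φ∧ψ≼A : (A ∧ᵣ φ) ∧ᵣ ψ ≼ A
      A∧φ∧ψ≼A = subst (_≼ A) (trans (⊗-singleton _ ψ) (cong (_∧ᵣ ψ) (⊗-singleton A φ)))
        (proj₂ (weak-coupling A (φ ∷ []) (ψ ∷ []) (Rev≼⇒≃⊗ Aφ) (Rev≼⇒≃⊗ Aψ)))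

      A∧φ∧ψ⊑A∧[φ∧ψ] : (A ∧ᵣ φ) ∧ᵣ ψ ⊑ A ∧ᵣ (φ ∧′ ψ)
      A∧φ∧ψ⊑A∧[φ∧ψ] = subst (_⊑ A ∧ᵣ (φ ∧′ ψ)) (map-∘ A) (map-⊑ A λ _ → ∧-assoc-⊢₁)

    Rev≼-BeliefSet : ∀ A → BeliefSet (Rev≼ A)
    Rev≼-BeliefSet A = ⊢₁-∧-closed⇒BeliefSet Rev≼-⊢₁ (Rev≼-⊤ A) Rev≼-∧

    Rev≼-⊆ : ∀ {A B} → A ≃ B → Rev≼ A ⊆ Rev≼ B
    Rev≼-⊆ {A} {B} (A≼B , B≼A) φ Aφ = ≼-∧ᵣ B φ
      , ≼-trans (B ∧ᵣ φ) ((A ⊗ B) ∧ᵣ φ) B (counter-dominance _ _ (∧ᵣ-mono-⊑ (⊗-⊑ʳ {A})))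
          (≼-trans _ A B A⊗B∧φ≼A A≼B)
      where
      A⊗B∧φ≼A : (A ⊗ B) ∧ᵣ φ ≼ A
      A⊗B∧φ≼A = subst (_≼ A) (⊗-singleton (A ⊗ B) φ)
        (proj₂ (weak-coupling A B (φ ∷ []) (coupling A B (A≼B , B≼A)) (Rev≼⇒≃⊗ Aφ)))

    meets-rev⇒≼ : ∀ {A B} → ¬ A ≡ [] → Meets B (rev A) → B ≼ A
    meets-rev⇒≼ {A} {B} A≢[] (ψ , ψ∈B , revAψ) =
      ≼-trans B (ψ ∷ []) A (counter-dominance _ _ (⊆⇒⊑ λ { (here refl) → ψ∈B }))
        (≼-trans _ _ _ (counter-dominance _ _ ∧ᵣ-⊑-singleton)
          (proj₂ (proj₁ (rev≐Rev≼ A≢[] ψ) revAψ)))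

    ≼-singleton : ∀ φ A → ∃[ ψ ] (ψ ∈ φ ∷ A × (ψ ∷ []) ≼ (φ ∷ A))
    ≼-singleton φ [] = φ , here refl , ≼-refl _
    ≼-singleton φ (χ ∷ A) with union (φ ∷ []) (χ ∷ A)
    ... | inj₁ [φ]≼ = φ , here refl , [φ]≼
    ... | inj₂ A≼ with ≼-singleton χ A
    ...   | ψ , ψ∈A , [ψ]≼A = ψ , there ψ∈A , ≼-trans _ _ _ [ψ]≼A A≼

    closure : Closure
    closure [] = BeliefSet-resp-≐ rev[]≐K K-closed
    closure A@(_ ∷ _) = BeliefSet-resp-≐ (rev≐Rev≼ {A} λ ()) (Rev≼-BeliefSet A)

    success : Success
    success [] A≢[] = ⊥-elim (A≢[] refl)
    success (φ ∷ A) A≢[] with ≼-singleton φ A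
    ... | ψ , ψ∈A , [ψ]≼A = ψ , ψ∈A , proj₂ (rev≐Rev≼ A≢[] ψ)
      (subst ((φ ∷ A) ≃_) (⊗-singleton (φ ∷ A) ψ)
        (coupling (φ ∷ A) (ψ ∷ []) (counter-dominance _ _ (⊆⇒⊑ λ { (here refl) → ψ∈A }) , [ψ]≼A)))

    vacuity : Vacuity
    vacuity [] refl = rev[]≐K

    confirmation : Confirmation
    confirmation A A∩K@(ψ , ψ∈A , Kψ) = ≐-trans (rev≐Rev≼ (Meets⇒≢[] A∩K)) λ χ → Rev≼⇒K , K⇒Rev≼
      where
      K⇒Rev≼ : ∀ {χ} → K χ → Rev≼ A χ
      K⇒Rev≼ {χ} Kχ = ≼-∧ᵣ A χ
        , proj₂ (minimality _) (ψ ∧′ χ , ∈-map⁺ (_∧′ χ) ψ∈A , BeliefSet-∧ K-closed Kψ Kχ) A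

      Rev≼⇒K : ∀ {χ} → Rev≼ A χ → K χ
      Rev≼⇒K {χ} (_ , A∧χ≼A)
        with proj₁ (minimality (A ∧ᵣ χ)) (λ B → ≼-trans _ _ _ A∧χ≼A (proj₂ (minimality A) A∩K B))
      ... | _ , φ∧χ∈ , Kφ∧χ with ∈-map⁻ (_∧′ χ) φ∧χ∈
      ...   | _ , _ , refl = BeliefSet-⊢₁ K-closed Kφ∧χ ∧-⊢₁ʳ

    reciprocity : Reciprocity
    reciprocity A B B∩revA A∩revB =
      ≐-trans (rev≐Rev≼ A≢[]) (≐-trans Rev≼A≐Rev≼B (≐-sym (rev≐Rev≼ B≢[])))
      where
      A≢[] = Meets⇒≢[] A∩revB
      B≢[] = Meets⇒≢[] B∩revA

      A≃B : A ≃ B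
      A≃B = meets-rev⇒≼ B≢[] A∩revB , meets-rev⇒≼ A≢[] B∩revA

      Rev≼A≐Rev≼B : Rev≼ A ≐ Rev≼ B
      Rev≼A≐Rev≼B φ = Rev≼-⊆ A≃B φ , Rev≼-⊆ (proj₂ A≃B , proj₁ A≃B) φ

    consistency : Consistency
    consistency [] _ rev[]⊢⊥ = K-consistent (monotony (rev []) K (proj₁ ∘ rev[]≐K) ⊥′ rev[]⊢⊥)
    consistency A@(_ ∷ _) A≢ₗ⊥ revA⊢⊥ = A≢ₗ⊥ (maximality A (λ ()) below-A)
      where
      A∧⊥≼A : A ∧ᵣ ⊥′ ≼ A
      A∧⊥≼A = proj₂ (proj₁ (rev≐Rev≼ {A} (λ ()) ⊥′) (proj₁ (closure A ⊥′) revA⊢⊥))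

      below-A : ∀ B → ¬ B ≡ [] → B ≼ A
      below-A [] B≢[] = ⊥-elim (B≢[] refl)
      below-A (ψ ∷ B) _ = ≼-trans _ _ _
        (counter-dominance _ _ (⊑-trans ∧ᵣ-⊑-singleton λ { _ (here refl) → ψ , here refl , ⊥-⊢₁ }))
        A∧⊥≼A

    postulates : AllPostulates
    postulates = closure , success , vacuity , confirmation , reciprocity , consistency

module Construction {Atom : Set} (C : ConsequenceOp Atom) (K : Sent Atom)
  (K-closed : WithCn.BeliefSet C K) (K-consistent : WithCn.Consistent C K)
  (R : WithCn.ChoiceRevision C K) where
  open WithCn C
  open Entailment C
  open ChoiceRevision R renaming (_∗_ to rev)
  open Postulates R

  _≼_ : Rel₂
  A ≼ B = Meets A (rev (A ++ B)) ⊎ B ≡ []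

  open MB K _≼_

  rev-resp-⊆⊇ : ∀ {A B} → A ⊆ₗ B → B ⊆ₗ A → rev A ≐ rev B
  rev-resp-⊆⊇ {A} {B} A⊆B B⊆A = set-invariant A B λ _ → A⊆B , B⊆A

  rev-++-comm : ∀ A B → rev (A ++ B) ≐ rev (B ++ A)
  rev-++-comm A B = rev-resp-⊆⊇ (++-⊆ₗ (xs⊆ys++xs A B) (xs⊆xs++ys B A))
                                (++-⊆ₗ (xs⊆ys++xs B A) (xs⊆xs++ys A B))

  rev-++-absorb : ∀ {A B} → A ⊆ₗ B → rev (A ++ B) ≐ rev B
  rev-++-absorb {A} A⊆B = rev-resp-⊆⊇ (++-⊆ₗ A⊆B id) (∈-++⁺ʳ A)

  module _ (closure : Closure) (success : Success) (vacuity : Vacuity)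
    (confirmation : Confirmation) (reciprocity : Reciprocity) (consistency : Consistency) where

    success-⊑ : ∀ {Z X} → ¬ Z ≡ [] → Z ⊑ X → Meets X (rev Z)
    success-⊑ {Z} Z≢[] Z⊑X with success Z Z≢[]
    ... | ζ , ζ∈Z , revZζ with Z⊑X ζ ζ∈Z
    ...   | ξ , ξ∈X , ζ⊢ξ = ξ , ξ∈X , BeliefSet-⊢₁ (closure Z) revZζ ζ⊢ξ

    rev-≐-⊑ : ∀ {Z X} → Z ⊑ X → Meets Z (rev X) → rev Z ≐ rev X
    rev-≐-⊑ Z⊑X Z∩revX = reciprocity _ _ (success-⊑ (Meets⇒≢[] Z∩revX) Z⊑X) Z∩revX

    rev-≐-⊆ : ∀ {Z X} → Z ⊆ₗ X → Meets Z (rev X) → rev Z ≐ rev X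
    rev-≐-⊆ = rev-≐-⊑ ∘ ⊆⇒⊑

    rev-++-⊑ : ∀ {P A} → P ⊑ A → ¬ A ≡ [] → rev (P ++ A) ≐ rev A
    rev-++-⊑ {P} {A} P⊑A A≢[] with success A A≢[]
    ... | φ , φ∈A , revAφ = rev-≐-⊑ (++-⊑ P⊑A ⊑-refl) (φ , ∈-++⁺ʳ P φ∈A , revAφ)

    counter-dominance : CounterDominance
    counter-dominance A [] _ = inj₂ refl
    counter-dominance A (φ ∷ B) B⊑A =
      inj₁ (success-⊑ (∈⇒≢[] (∈-++⁺ʳ A (here refl))) (++-⊑ ⊑-refl B⊑A))

    ≼-refl : ∀ A → A ≼ A
    ≼-refl A = counter-dominance A A ⊑-refl

    ≃-of-⊑ : ∀ {A W} → W ⊑ A → Meets W (rev A) → A ≃ W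
    ≃-of-⊑ {A} {W} W⊑A (ω , ω∈W , revAω) =
      counter-dominance A W W⊑A , inj₁ (ω , ω∈W , proj₂ (rev-++-⊑ W⊑A A≢[] ω) revAω)
      where
      A≢[] = ∈⇒≢[] (proj₁ (proj₂ (W⊑A ω ω∈W)))

    ≼⇒meets-rev : ∀ {A W} → W ⊑ A → ¬ A ≡ [] → W ≼ A → Meets W (rev A)
    ≼⇒meets-rev _ A≢[] (inj₂ A≡[]) = ⊥-elim (A≢[] A≡[])
    ≼⇒meets-rev W⊑A A≢[] (inj₁ (ω , ω∈W , revω)) = ω , ω∈W , proj₁ (rev-++-⊑ W⊑A A≢[] ω) revω

    ⊗≼⇒meets-rev : ∀ {A D} → ¬ A ≡ [] → (A ⊗ D) ≼ A → Meets D (rev A)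
    ⊗≼⇒meets-rev {A} {D} A≢[] A⊗D≼A with ≼⇒meets-rev ⊗-⊑ˡ A≢[] A⊗D≼A
    ... | χ , χ∈A⊗D , revAχ with ∈-⊗⁻ A D χ∈A⊗D
    ...   | _ , ψ , _ , ψ∈D , refl = ψ , ψ∈D , BeliefSet-⊢₁ (closure A) revAχ ∧-⊢₁ʳ

    -- Whichever of A, B, C the revision by A ∪ B ∪ C selects from,
    -- reciprocity carries the selection back to a member of A.
    ≼-trans : Transitivity
    ≼-trans _ _ _ _ (inj₂ refl) = inj₂ refl
    ≼-trans _ _ _ (inj₂ refl) (inj₁ (_ , () , _))
    ≼-trans A B C (inj₁ (α , α∈A , revα)) (inj₁ (β , β∈B , revβ)) =
      inj₁ (selected (success D (∈⇒≢[] (∈-++⁺ˡ α∈A))))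
      where
      D = A ++ B ++ C

      A++C⊆D : A ++ C ⊆ₗ D
      A++C⊆D = ++-⊆ₗ (xs⊆xs++ys A (B ++ C)) (∈-++⁺ʳ A ∘ xs⊆ys++xs C B)

      A++B⊆D : A ++ B ⊆ₗ D
      A++B⊆D = ++-⊆ₗ (xs⊆xs++ys A (B ++ C)) (∈-++⁺ʳ A ∘ xs⊆xs++ys B C)

      rev≐revD : ∀ {X δ} → X ⊆ₗ D → δ ∈ X → rev D δ → rev X ≐ rev D
      rev≐revD X⊆D δ∈X revDδ = rev-≐-⊆ X⊆D (_ , δ∈X , revDδ)

      via-A : ∀ {δ} → δ ∈ A → rev D δ → Meets A (rev (A ++ C))
      via-A δ∈A revDδ = _ , δ∈A , proj₂ (rev≐revD A++C⊆D (∈-++⁺ˡ δ∈A) revDδ _) revDδ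

      via-B : ∀ {δ} → δ ∈ B → rev D δ → Meets A (rev (A ++ C))
      via-B δ∈B revDδ = via-A α∈A (proj₁ (rev≐revD A++B⊆D (∈-++⁺ʳ A δ∈B) revDδ α) revα)

      via-C : ∀ {δ} → δ ∈ C → rev D δ → Meets A (rev (A ++ C))
      via-C δ∈C revDδ = via-B β∈B (proj₁ (rev≐revD (∈-++⁺ʳ A) (∈-++⁺ʳ B δ∈C) revDδ β) revβ)

      selected : Meets D (rev D) → Meets A (rev (A ++ C))
      selected (δ , δ∈D , revDδ) =
        [ (λ δ∈A → via-A δ∈A revDδ)
        , [ (λ δ∈B → via-B δ∈B revDδ) , (λ δ∈C → via-C δ∈C revDδ) ]′ ∘ ∈-++⁻ B
        ]′ (∈-++⁻ A δ∈D)

    completeness : Completeness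
    completeness A [] = inj₁ (inj₂ refl)
    completeness [] (_ ∷ _) = inj₂ (inj₂ refl)
    completeness A@(_ ∷ _) B@(_ ∷ _) with success (A ++ B) (λ ())
    ... | χ , χ∈A++B , revχ with ∈-++⁻ A χ∈A++B
    ...   | inj₁ χ∈A = inj₁ (inj₁ (χ , χ∈A , revχ))
    ...   | inj₂ χ∈B = inj₂ (inj₁ (χ , χ∈B , proj₁ (rev-++-comm A B χ) revχ))

    determination : Determination
    determination A A≢[] = inj₂ refl , λ { (inj₁ (_ , () , _)) ; (inj₂ A≡[]) → A≢[] A≡[] }

    union : Union
    union [] B = inj₂ (≼-refl B)
    union A@(_ ∷ _) B with success (A ++ B) (λ ())
    ... | χ , χ∈A++B , revχ with ∈-++⁻ A χ∈A++B
    ...   | inj₁ χ∈A = inj₁ (inj₁ (χ , χ∈A , proj₂ (rev-++-absorb (xs⊆xs++ys A B) χ) revχ))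
    ...   | inj₂ χ∈B = inj₂ (inj₁ (χ , χ∈B , proj₂ (rev-++-absorb (xs⊆ys++xs B A) χ) revχ))

    minimality : Minimality
    minimality A = least⇒meets , meets⇒least
      where
      least⇒meets : (∀ B → A ≼ B) → Meets A K
      least⇒meets A-least with A-least (⊤′ ∷ [])
      ... | inj₁ (φ , φ∈A , revφ) = φ , φ∈A
        , proj₁ (confirmation (A ++ ⊤′ ∷ []) A++⊤∩K φ) revφ
        where
        A++⊤∩K : Meets (A ++ ⊤′ ∷ []) K
        A++⊤∩K = ⊤′ , ∈-++⁺ʳ A (here refl) , BeliefSet-⊤ K-closed

      meets⇒least : Meets A K → ∀ B → A ≼ B
      meets⇒least (φ , φ∈A , Kφ) B =
        inj₁ (φ , φ∈A , proj₂ (confirmation (A ++ B) (φ , ∈-++⁺ˡ φ∈A , Kφ) φ) Kφ)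

    maximality : Maximality
    maximality [] B≢[] _ = ⊥-elim (B≢[] refl)
    maximality (φ ∷ B) _ B-greatest with B-greatest (⊥′ ∷ []) (λ ())
    ... | inj₁ (_ , there () , _)
    ... | inj₁ (_ , here refl , rev⊥) = ⊢₁⊥⇒≡ₗ⊥ entails-⊥
      where
      ∅-consistent : Consistent ⟦ [] ⟧
      ∅-consistent = K-consistent ∘ monotony ⟦ [] ⟧ K (λ _ ()) ⊥′

      entails-⊥ : ∀ {ψ} → ψ ∈ φ ∷ B → ψ ⊢₁ ⊥′
      entails-⊥ ψ∈B = ¬¬-elim ∅-consistent λ ψ⊬⊥ →
        consistency (⊥′ ∷ φ ∷ B) (ψ⊬⊥ ∘ λ ≡ₗ⊥ → ≡ₗ⊥⇒⊢₁⊥ ≡ₗ⊥ (there ψ∈B)) (inclusion _ ⊥′ rev⊥)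

    coupling : Coupling
    coupling [] B _ = ≼-refl [] , ≼-refl []
    coupling (_ ∷ _) _ (_ , inj₂ ())
    coupling (_ ∷ _) [] (_ , inj₁ (_ , () , _))
    coupling (_ ∷ _) (_ ∷ _) (inj₂ () , _)
    coupling A@(_ ∷ _) B@(_ ∷ _) (inj₁ A∩rev@(α , α∈A , revα) , inj₁ (β , β∈B , revβ)) =
      ≃-of-⊑ ⊗-⊑ˡ (α ∧′ β , ∈-⊗⁺ α∈A β∈B
        , BeliefSet-∧ (closure A) (proj₂ (revA≐revA++B α) revα)
                                  (proj₂ (revA≐revA++B β) (proj₁ (rev-++-comm B A β) revβ)))
      where
      revA≐revA++B : rev A ≐ rev (A ++ B)
      revA≐revA++B = rev-≐-⊆ (xs⊆xs++ys A B) A∩rev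

    weak-coupling : WeakCoupling
    weak-coupling [] B C _ _ = ≼-refl [] , ≼-refl []
    weak-coupling A@(_ ∷ _) B C (_ , A⊗B≼A) (_ , A⊗C≼A)
      with success A (λ ()) | ⊗≼⇒meets-rev (λ ()) A⊗B≼A | ⊗≼⇒meets-rev (λ ()) A⊗C≼A
    ... | α , α∈A , revα | β , β∈B , revβ | γ , γ∈C , revγ =
      ≃-of-⊑ (⊑-trans (⊗-⊑ˡ {A ⊗ B} {C}) (⊗-⊑ˡ {A} {B}))
        ((α ∧′ β) ∧′ γ , ∈-⊗⁺ (∈-⊗⁺ α∈A β∈B) γ∈C
        , BeliefSet-∧ (closure A) (BeliefSet-∧ (closure A) revα revβ) revγ)

    standard : Standard
    standard = ≼-trans , weak-coupling , coupling , counter-dominance , minimality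
             , maximality , completeness , determination , union

    represents : Represents R
    represents [] = (λ []≺[] → ⊥-elim (proj₂ []≺[] (inj₂ refl))) , λ _ → vacuity [] refl
    represents A@(_ ∷ _) = (λ _ χ → rev⇒≃ , ≃⇒rev)
                         , λ A⊀[] → ⊥-elim (A⊀[] (determination A λ ()))
      where
      rev⇒≃ : ∀ {χ} → rev A χ → A ≃ A ∧ᵣ χ
      rev⇒≃ {χ} revχ with success A (λ ())
      ... | α , α∈A , revα =
        ≃-of-⊑ ∧ᵣ-⊑ (α ∧′ χ , ∈-map⁺ (_∧′ χ) α∈A , BeliefSet-∧ (closure A) revα revχ)

      ≃⇒rev : ∀ {χ} → A ≃ A ∧ᵣ χ → rev A χ
      ≃⇒rev {χ} (_ , A∧χ≼A) with ≼⇒meets-rev ∧ᵣ-⊑ (λ ()) A∧χ≼A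
      ... | _ , ψ∧χ∈ , revψ∧χ with ∈-map⁻ (_∧′ χ) ψ∧χ∈
      ...   | _ , _ , refl = BeliefSet-⊢₁ (closure A) revψ∧χ ∧-⊢₁ʳ

theorem5 : {Atom : Set} (C : ConsequenceOp Atom) (K : Sent Atom)
    → WithCn.BeliefSet C K → WithCn.Consistent C K
    → (R : WithCn.ChoiceRevision C K)
    → WithCn.Postulates.AllPostulates C R
    ⇔ (∃[ ≼ ] (WithCn.MB.Standard C K ≼ × WithCn.MB.Represents C K ≼ R))
theorem5 C K K-closed K-consistent R = mk⇔
  (λ { (cl , su , va , co , re , cs) →
       _≼_ , standard cl su va co re cs , represents cl su va co re cs })
  (λ { (_≼_ , (tr , wc , cp , cd , mn , mx , _ , dt , un) , rep) →
       Soundness.postulates C K K-closed K-consistent R _≼_ tr wc cp cd mn mx dt un rep })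
  where open Construction C K K-closed K-consistent R
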